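{- Let $\mathfrak{X}=(\Gamma,c:\Gamma^2\to\mathcal{C})$ be a configuration. Call an edge colour $c_0\in\mathcal{C}$ nonempty if for every $v\in\Gamma$ there is at most one $w\in\Gamma$ with $c(v,w)=c_0$, and empty otherwise. Let $\Gamma_{\mathfrak{X}}$ be the graph with vertex set $\Gamma$ and edge set $\{(v_1,v_2)\in\Gamma^2: c(v_1,v_2) \text{ is a nonempty edge colour}\}$, and suppose $\Gamma_{\mathfrak{X}}$ is connected. Then the number $WL(\mathfrak{X})$ of nontrivial iterations of the Weisfeiler-Leman algorithm applied to $\mathfrak{X}$ satisfies $$WL(\mathfrak{X})\leq\log_2\mathrm{diam}\,\Gamma_{\mathfrak{X}}+3 .$$
   Context: A (classical) configuration is a pair $(\Gamma,c)$ with $\Gamma$ a finite set and $c:\Gamma^2\to\mathcal{C}$ a map to a finite set of colours such that: (i) if some $c_0\in\mathcal{C}$ satisfies $c(v,v)=c_0$ for some $v$, then $c(v_1,v_2)=c_0$ implies $v_1=v_2$; (ii) for every $c_0\in\mathcal{C}$ there is $c_0^{ -1}\in\mathcal{C}$ such that $c(v_1,v_2)=c_0$ implies $c(v_2,v_1)=c_0^{ -1}$. Colours of the form $c(v,v)$ are vertex colours; the others are edge colours. Connectedness of $\Gamma_{\mathfrak{X}}$ is understood so that any vertex can be reached from any other by a directed path, and $\mathrm{diam}\,\Gamma_{\mathfrak{X}}$ is the maximum over ordered pairs of the length of a shortest directed path. Weisfeiler-Leman algorithm: put $c^{(0)}=c$, $\mathcal{C}^{(0)}=\mathcal{C}$,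 and define $c^{(h+1)}(v_1,v_2)$ to be the tuple consisting of $c^{(h)}(v_1,v_2)$ together with the family of numbers $\left|\{w\in\Gamma: c^{(h)}(v_1,w)=c_1,\ c^{(h)}(w,v_2)=c_2\}\right|$ indexed by $(c_1,c_2)\in\mathcal{C}^{(h)}\times\mathcal{C}^{(h)}$; $\mathcal{C}^{(h+1)}$ is the set of values of $c^{(h+1)}$. The number of nontrivial iterations $WL(\mathfrak{X})$ is the least $h\geq0$ such that the partition of $\Gamma^2$ into colour classes of $c^{(h+1)}$ equals that of $c^{(h)}$. -}

module Defs where

open import Data.Nat using (ℕ; zero; suc; _+_; _≤_; _<_; _≡ᵇ_)
open import Data.Fin using (Fin; _≟_)
open import Data.Bool using (Bool; true; false; _∧_; if_then_else_)
open import Data.List using (List; allFin; cartesianProduct; map)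
open import Data.Nat.ListAction using (sum)
open import Data.Bool.ListAction using (all)
open import Data.Product using (Σ; ∃; _×_; _,_)
open import Relation.Nullary using (¬_; does)
open import Relation.Binary.PropositionalEquality using (_≡_)

record Configuration : Set where
  field
    n : ℕ
    k : ℕ
    c : Fin n → Fin n → Fin k
    vertexAx : ∀ v v₁ v₂ → c v₁ v₂ ≡ c v v → v₁ ≡ v₂
    inverseAx : ∀ (c₀ : Fin k) → ∃ λ c₀⁻¹ →
                  ∀ v₁ v₂ → c v₁ v₂ ≡ c₀ → c v₂ v₁ ≡ c₀⁻¹

module _ (𝔛 : Configuration) where
  open Configuration 𝔛

  Pair : Set
  Pair = Fin n × Fin n

  pairs : List Pair
  pairs = cartesianProduct (allFin n) (allFin n)

  NonemptyEdgeColour : Fin k → Set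
  NonemptyEdgeColour c₀ =
    (∀ v → ¬ (c v v ≡ c₀)) ×
    (∀ v w w′ → c v w ≡ c₀ → c v w′ ≡ c₀ → w ≡ w′)

  Edge : Fin n → Fin n → Set
  Edge v w = NonemptyEdgeColour (c v w)

  data Walk : Fin n → Fin n → ℕ → Set where
    here : ∀ {v} → Walk v v zero
    step : ∀ {u v w ℓ} → Edge u v → Walk v w ℓ → Walk u w (suc ℓ)

  Connected : Set
  Connected = ∀ v w → ∃ λ ℓ → Walk v w ℓ

  IsDiameter : ℕ → Set
  IsDiameter D =
    (∀ v w → ∃ λ ℓ → ℓ ≤ D × Walk v w ℓ) ×
    (∃ λ v → ∃ λ w → ∀ ℓ → Walk v w ℓ → D ≤ ℓ)

  -- Weisfeiler-Leman: sameColour h p q = true iff c⁽ʰ⁾(p) = c⁽ʰ⁾(q).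
  -- Colour classes of c⁽ʰ⁾ are indexed by representative pairs; counts
  -- for colours not attained are 0 on both sides, so quantifying over
  -- representative pairs a, b is the same as over (c₁,c₂) ∈ 𝒞⁽ʰ⁾×𝒞⁽ʰ⁾.
  countTrue : List Bool → ℕ
  countTrue bs = sum (map (λ b → if b then 1 else 0) bs)

  mutual
    sameColour : ℕ → Pair → Pair → Bool
    sameColour zero (v₁ , v₂) (u₁ , u₂) = does (c v₁ v₂ ≟ c u₁ u₂)
    sameColour (suc h) p q =
      sameColour h p q ∧
      all (λ a → all (λ b → count h p a b ≡ᵇ count h q a b) pairs) pairs

    count : ℕ → Pair → Pair → Pair → ℕ
    count h (v₁ , v₂) a b =
      countTrue (map (λ w → sameColour h (v₁ , w) a ∧ sameColour h (w , v₂) b)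
                     (allFin n))

  Stable : ℕ → Set
  Stable h = ∀ p q → sameColour (suc h) p q ≡ sameColour h p q

  IsWL : ℕ → Set
  IsWL h = Stable h × (∀ h′ → h′ < h → ¬ Stable h′)

-- Colours of WL refinement level h see colour words of walks of length at most 2^h: if a walk
-- with colour word σ, |σ| ≤ 2^h, joins v to w, then it joins v′ to w′ for every pair (v′ , w′)
-- of the same level-h colour (split σ in halves and use the counting condition to find a
-- midpoint). Nonempty colours are functional, so a colour word and a start determine the end;
-- hence once 2^m bounds the diameter, every level-m colour class meets each row {v} × Γ at most
-- once. Two pairs of equal level-(m+2) colour then induce a row-by-row matching of Γ which is a
-- colour-preserving bijection, i.e. an automorphism mapping one pair onto the other, and
-- automorphisms preserve all refined colours. So the partition is stable at level m + 2, and
-- m = ⌊log₂ D⌋ + 1 works.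
module Submission where

open import Defs
open import Data.Nat using (ℕ; _≤_; _+_)
open import Data.Nat.Logarithm using (⌊log₂_⌋)
open import Data.Product using (∃; _×_)

open import Data.Nat using (zero; suc; _<_; _∸_; _^_; z≤n; s≤s)
import Data.Nat.Properties as ℕ
open import Data.Nat.Logarithm using (⌊log₂⌋-mono-≤; ⌊log₂[2^n]⌋≡n)
open import Data.Nat.ListAction using (sum)
open import Data.Fin as Fin using (Fin)
import Data.Fin.Properties as Fin
open import Data.Fin.Permutation using (Permutation′; permutation; _⟨$⟩ʳ_)
open import Data.Bool using (Bool; true; false; T; _∧_; if_then_else_)
import Data.Bool.Properties as Bool
open import Data.Bool.ListAction using (all)
open import Data.List using (List; []; _∷_; _++_; length; map; tabulate; allFin; take; drop)
import Data.List.Properties as List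
open import Data.List.Membership.Propositional using (_∈_)
open import Data.List.Membership.Propositional.Properties using (∈-allFin; ∈-cartesianProduct⁺)
open import Data.List.Relation.Unary.Any using (here; there)
import Data.List.Relation.Unary.All as All
import Data.List.Relation.Unary.All.Properties as All
open import Data.Product using (_,_; proj₁; proj₂)
open import Data.Sum using (inj₁; inj₂)
open import Function using (_∘_; id; Equivalence)
open import Relation.Nullary using (¬_; Dec; yes; no; contradiction)
open import Relation.Nullary.Decidable using (map′)
open import Relation.Unary using (Decidable)
open import Relation.Binary.PropositionalEquality
open import Algebra.Properties.CommutativeMonoid.Sum ℕ.+-0-commutativeMonoid
  using (sum-permute) renaming (sum to ∑)

T-antisym : ∀ {x y} → (T x → T y) → (T y → T x) → x ≡ y
T-antisym {false} {false} _   _   = refl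
T-antisym {false} {true}  _   y⇒x = contradiction _ y⇒x
T-antisym {true}  {false} x⇒y _   = contradiction _ x⇒y
T-antisym {true}  {true}  _   _   = refl

sum-tabulate : ∀ {m} (f : Fin m → ℕ) → sum (tabulate f) ≡ ∑ f
sum-tabulate {zero}  f = refl
sum-tabulate {suc m} f = cong (f Fin.zero +_) (sum-tabulate (f ∘ Fin.suc))

∀-pair? : ∀ {m} {P : Fin m × Fin m → Set} → (∀ p → Dec (P p)) → Dec (∀ p → P p)
∀-pair? P? = map′ (λ ∀P (i , j) → ∀P i j) (λ ∀P i j → ∀P (i , j))
                  (Fin.all? (λ i → Fin.all? (λ j → P? (i , j))))

least-search : ∀ {P : ℕ → Set} → Decidable P → ∀ k d → (∀ h → h < k → ¬ P h) → P (d + k) →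
               ∃ λ h → (P h × ∀ h′ → h′ < h → ¬ P h′) × h ≤ d + k
least-search {P} P? k d none Pd+k with P? k
... | yes Pk = k , (Pk , none) , ℕ.m≤n+m k d
least-search P? k zero    none Pk   | no ¬Pk = contradiction Pk ¬Pk
least-search {P} P? k (suc d) none Pd+k | no ¬Pk =
  let h , least , h≤ = least-search P? (suc k) d none′ (subst P (sym (ℕ.+-suc d k)) Pd+k)
  in h , least , ℕ.≤-trans h≤ (ℕ.≤-reflexive (ℕ.+-suc d k))
  where
  none′ : ∀ h → h < suc k → ¬ P h
  none′ h h<1+k with ℕ.m<1+n⇒m<n∨m≡n h<1+k
  ... | inj₁ h<k  = none h h<k
  ... | inj₂ refl = ¬Pk

least-satisfying : ∀ {P : ℕ → Set} → Decidable P → ∀ {H} → P H →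
                   ∃ λ h → (P h × ∀ h′ → h′ < h → ¬ P h′) × h ≤ H
least-satisfying {P} P? {H} PH =
  subst (λ x → ∃ λ h → _ × h ≤ x) (ℕ.+-identityʳ H)
        (least-search P? 0 H (λ _ ()) (subst P (sym (ℕ.+-identityʳ H)) PH))

<2^suc⌊log₂⌋ : ∀ x → x < 2 ^ suc ⌊log₂ x ⌋
<2^suc⌊log₂⌋ x with 2 ^ suc ⌊log₂ x ⌋ ℕ.≤? x
... | no  2^≰x = ℕ.≰⇒> 2^≰x
... | yes 2^≤x = contradiction (subst (_≤ ⌊log₂ x ⌋) (⌊log₂[2^n]⌋≡n _) (⌊log₂⌋-mono-≤ 2^≤x))
                               (ℕ.n≮n _)

module _ (𝔛 : Configuration) where
  open Configuration 𝔛

  countTrue-pos⁺ : ∀ {A : Set} (g : A → Bool) {x xs} → x ∈ xs → T (g x) →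
                   1 ≤ countTrue 𝔛 (map g xs)
  countTrue-pos⁺ g {xs = y ∷ _} (here refl) gy with g y | gy
  ... | true | _ = s≤s z≤n
  countTrue-pos⁺ g {xs = y ∷ _} (there x∈) gx with g y
  ... | true  = s≤s z≤n
  ... | false = countTrue-pos⁺ g x∈ gx

  countTrue-pos⁻ : ∀ {A : Set} (g : A → Bool) xs → 1 ≤ countTrue 𝔛 (map g xs) → ∃ λ x → T (g x)
  countTrue-pos⁻ g (x ∷ xs) 1≤ with g x in gx
  ... | true  = x , subst T (sym gx) _
  ... | false = countTrue-pos⁻ g xs 1≤

  countTrue-allFin : ∀ {m} (g : Fin m → Bool) →
                     countTrue 𝔛 (map g (allFin m)) ≡ ∑ (λ i → if g i then 1 else 0)
  countTrue-allFin g = trans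
    (cong sum (trans (cong (map _) (List.map-tabulate id g)) (List.map-tabulate g _)))
    (sum-tabulate (λ i → if g i then 1 else 0))

  countTrue-permute : ∀ {m} (π : Permutation′ m) (g : Fin m → Bool) →
                      countTrue 𝔛 (map g (allFin m)) ≡ countTrue 𝔛 (map (g ∘ (π ⟨$⟩ʳ_)) (allFin m))
  countTrue-permute π g = trans (countTrue-allFin g)
    (trans (sum-permute _ π) (sym (countTrue-allFin (g ∘ (π ⟨$⟩ʳ_)))))

  ∈-pairs : ∀ p → p ∈ pairs 𝔛
  ∈-pairs (v , w) = ∈-cartesianProduct⁺ (∈-allFin v) (∈-allFin w)

  T-all-pairs⁻ : ∀ {g : Pair 𝔛 → Bool} → T (all g (pairs 𝔛)) → ∀ p → T (g p)
  T-all-pairs⁻ t p = All.lookup (All.all⁺ _ _ t) (∈-pairs p)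

  T-all-pairs⁺ : ∀ {g : Pair 𝔛 → Bool} → (∀ p → T (g p)) → T (all g (pairs 𝔛))
  T-all-pairs⁺ {g} t = All.all⁻ g (All.universal t (pairs 𝔛))

  SameColour : ℕ → Pair 𝔛 → Pair 𝔛 → Set
  SameColour h p q = T (sameColour 𝔛 h p q)

  sameColour-zero⁺ : ∀ {v₁ v₂ u₁ u₂} → c v₁ v₂ ≡ c u₁ u₂ → SameColour 0 (v₁ , v₂) (u₁ , u₂)
  sameColour-zero⁺ {v₁} {v₂} {u₁} {u₂} eq with c v₁ v₂ Fin.≟ c u₁ u₂
  ... | yes _  = _
  ... | no neq = neq eq

  sameColour-suc⁺ : ∀ h {p q} → SameColour h p q →
                    (∀ a b → count 𝔛 h p a b ≡ count 𝔛 h q a b) → SameColour (suc h) p q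
  sameColour-suc⁺ h s count≡ = Equivalence.from Bool.T-∧
    (s , T-all-pairs⁺ (λ a → T-all-pairs⁺ (λ b → ℕ.≡⇒≡ᵇ _ _ (count≡ a b))))

  sameColour-suc⁻ : ∀ h {p q} → SameColour (suc h) p q → SameColour h p q
  sameColour-suc⁻ h s = proj₁ (Equivalence.to Bool.T-∧ s)

  sameColour-suc⁻-count : ∀ h {p q} → SameColour (suc h) p q →
                          ∀ a b → count 𝔛 h p a b ≡ count 𝔛 h q a b
  sameColour-suc⁻-count h {p} s a b =
    ℕ.≡ᵇ⇒≡ _ _ (T-all-pairs⁻ (T-all-pairs⁻ (proj₂ (Equivalence.to (Bool.T-∧ {sameColour 𝔛 h p _}) s)) a) b)

  sameColour⇒c≡ : ∀ h {v₁ v₂ u₁ u₂} → SameColour h (v₁ , v₂) (u₁ , u₂) → c v₁ v₂ ≡ c u₁ u₂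
  sameColour⇒c≡ zero {v₁} {v₂} {u₁} {u₂} s with c v₁ v₂ Fin.≟ c u₁ u₂
  ... | yes eq = eq
  sameColour⇒c≡ (suc h) s = sameColour⇒c≡ h (sameColour-suc⁻ h s)

  sameColour-refl : ∀ h p → SameColour h p p
  sameColour-refl zero    p = sameColour-zero⁺ refl
  sameColour-refl (suc h) p = sameColour-suc⁺ h (sameColour-refl h p) (λ _ _ → refl)

  sameColour-sym : ∀ h {p q} → SameColour h p q → SameColour h q p
  sameColour-sym zero    {_ , _} {_ , _} s = sameColour-zero⁺ (sym (sameColour⇒c≡ 0 s))
  sameColour-sym (suc h) s = sameColour-suc⁺ h (sameColour-sym h (sameColour-suc⁻ h s))
    (λ a b → sym (sameColour-suc⁻-count h s a b))

  sameColour-trans : ∀ h {p q r} → SameColour h p q → SameColour h q r → SameColour h p r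
  sameColour-trans zero {_ , _} {_ , _} {_ , _} s t =
    sameColour-zero⁺ (trans (sameColour⇒c≡ 0 s) (sameColour⇒c≡ 0 t))
  sameColour-trans (suc h) s t =
    sameColour-suc⁺ h (sameColour-trans h (sameColour-suc⁻ h s) (sameColour-suc⁻ h t))
      (λ a b → trans (sameColour-suc⁻-count h s a b) (sameColour-suc⁻-count h t a b))

  sameColour-congˡ : ∀ h {p q} r → SameColour h p q → sameColour 𝔛 h p r ≡ sameColour 𝔛 h q r
  sameColour-congˡ h r s =
    T-antisym (sameColour-trans h (sameColour-sym h s)) (sameColour-trans h s)

  -- w itself is counted in count h (v₁ , v₂) (v₁ , w) (w , v₂); equal counts at (u₁ , u₂) yield w′.
  sameColour-suc⇒midpoint : ∀ h {v₁ v₂ u₁ u₂} → SameColour (suc h) (v₁ , v₂) (u₁ , u₂) →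
    ∀ w → ∃ λ w′ → SameColour h (v₁ , w) (u₁ , w′) × SameColour h (w , v₂) (w′ , u₂)
  sameColour-suc⇒midpoint h {v₁} {v₂} s w =
    let w′ , t = countTrue-pos⁻ _ (allFin n)
                   (subst (1 ≤_) (sameColour-suc⁻-count h s (v₁ , w) (w , v₂)) w-counted)
        t₁ , t₂ = Equivalence.to Bool.T-∧ t
    in w′ , sameColour-sym h t₁ , sameColour-sym h t₂
    where
    w-counted : 1 ≤ count 𝔛 h (v₁ , v₂) (v₁ , w) (w , v₂)
    w-counted = countTrue-pos⁺ _ (∈-allFin w)
      (Equivalence.from Bool.T-∧ (sameColour-refl h (v₁ , w) , sameColour-refl h (w , v₂)))

  sameColour-permute : (π : Permutation′ n) → (∀ x y → c (π ⟨$⟩ʳ x) (π ⟨$⟩ʳ y) ≡ c x y) →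
                       ∀ h x y → SameColour h (x , y) (π ⟨$⟩ʳ x , π ⟨$⟩ʳ y)
  sameColour-permute π preserves-c zero    x y = sameColour-zero⁺ (sym (preserves-c x y))
  sameColour-permute π preserves-c (suc h) x y =
    sameColour-suc⁺ h (sameColour-permute π preserves-c h x y) count≡
    where
    π[_] = π ⟨$⟩ʳ_
    count≡ : ∀ a b → count 𝔛 h (x , y) a b ≡ count 𝔛 h (π[ x ] , π[ y ]) a b
    count≡ a b = sym (trans (countTrue-permute π _) (cong (countTrue 𝔛) (List.map-cong (λ w →
      cong₂ _∧_ (sameColour-congˡ h a (sameColour-sym h (sameColour-permute π preserves-c h x w)))
                (sameColour-congˡ h b (sameColour-sym h (sameColour-permute π preserves-c h w y))))
      (allFin n))))

  data ColourWalk : Fin n → Fin n → List (Fin k) → Set where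
    []   : ∀ {v} → ColourWalk v v []
    edge : ∀ {u v w f cs} → Edge 𝔛 u v → c u v ≡ f → ColourWalk v w cs → ColourWalk u w (f ∷ cs)

  walk⇒colourWalk : ∀ {v w ℓ} → Walk 𝔛 v w ℓ → ∃ λ cs → length cs ≡ ℓ × ColourWalk v w cs
  walk⇒colourWalk here = [] , refl , []
  walk⇒colourWalk (step {u} {v} e r) =
    let cs , |cs| , r′ = walk⇒colourWalk r in c u v ∷ cs , cong suc |cs| , edge e refl r′

  colourWalk-deterministic : ∀ {v w w′ cs} → ColourWalk v w cs → ColourWalk v w′ cs → w ≡ w′
  colourWalk-deterministic [] [] = refl
  colourWalk-deterministic {v} (edge {v = x} e cx r) (edge {v = x′} _ cx′ r′)
    with proj₂ e v x x′ refl (trans cx′ (sym cx))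
  ... | refl = colourWalk-deterministic r r′

  colourWalk-splitAt : ∀ t {v w cs} → ColourWalk v w cs →
                       ∃ λ x → ColourWalk v x (take t cs) × ColourWalk x w (drop t cs)
  colourWalk-splitAt zero    r             = _ , [] , r
  colourWalk-splitAt (suc t) []            = _ , [] , []
  colourWalk-splitAt (suc t) (edge e cf r) =
    let x , r₁ , r₂ = colourWalk-splitAt t r in x , edge e cf r₁ , r₂

  colourWalk-++ : ∀ {v x w xs ys} → ColourWalk v x xs → ColourWalk x w ys → ColourWalk v w (xs ++ ys)
  colourWalk-++ []             r₂ = r₂
  colourWalk-++ (edge e cf r₁) r₂ = edge e cf (colourWalk-++ r₁ r₂)

  colourWalk-transport : ∀ h {cs v w v′ w′} → length cs ≤ 2 ^ h →
    SameColour h (v , w) (v′ , w′) → ColourWalk v w cs → ColourWalk v′ w′ cs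
  colourWalk-transport zero {v = v} {v′ = v′} {w′} _ s []
    with vertexAx v v′ w′ (sym (sameColour⇒c≡ 0 s))
  ... | refl = []
  colourWalk-transport zero _ s (edge e cf []) =
    let c≡ = sameColour⇒c≡ 0 s in edge (subst (NonemptyEdgeColour 𝔛) c≡ e) (trans (sym c≡) cf) []
  colourWalk-transport zero (s≤s ()) _ (edge _ _ (edge _ _ _))
  colourWalk-transport (suc h) {cs} {v′ = v′} {w′} |cs|≤ s r =
    let x , r₁ , r₂ = colourWalk-splitAt t r
        x′ , s₁ , s₂ = sameColour-suc⇒midpoint h s x
    in subst (ColourWalk v′ w′) (List.take++drop≡id t cs)
         (colourWalk-++ (colourWalk-transport h |take|≤ s₁ r₁) (colourWalk-transport h |drop|≤ s₂ r₂))
    where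
    t = 2 ^ h
    |take|≤ : length (take t cs) ≤ t
    |take|≤ = ℕ.≤-trans (ℕ.≤-reflexive (List.length-take t cs)) (ℕ.m⊓n≤m t _)
    |drop|≤ : length (drop t cs) ≤ t
    |drop|≤ = begin
      length (drop t cs) ≡⟨ List.length-drop t cs ⟩
      length cs ∸ t      ≤⟨ ℕ.m≤n+o⇒m∸n≤o _ t |cs|≤ ⟩
      t + 0              ≡⟨ ℕ.+-identityʳ t ⟩
      t                  ∎
      where open ℕ.≤-Reasoning

  WalksWithin : ℕ → Set
  WalksWithin L = ∀ v w → ∃ λ ℓ → ℓ ≤ L × Walk 𝔛 v w ℓ

  walksWithin-mono : ∀ {L L′} → L ≤ L′ → WalksWithin L → WalksWithin L′
  walksWithin-mono L≤L′ walks v w =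
    let ℓ , ℓ≤L , r = walks v w in ℓ , ℕ.≤-trans ℓ≤L L≤L′ , r

  module _ {m} (walks : WalksWithin (2 ^ m)) where

    sameColour-targetUnique : ∀ {v w v′ w′ w″} →
      SameColour m (v , w) (v′ , w′) → SameColour m (v , w) (v′ , w″) → w′ ≡ w″
    sameColour-targetUnique {v} {w} s s′ =
      let ℓ , ℓ≤ , walk = walks v w
          cs , |cs| , r = walk⇒colourWalk walk
          |cs|≤ = subst (_≤ 2 ^ m) (sym |cs|) ℓ≤
      in colourWalk-deterministic (colourWalk-transport m |cs|≤ s r) (colourWalk-transport m |cs|≤ s′ r)

    module Matching {v₁ v₂ u₁ u₂} (s : SameColour (2 + m) (v₁ , v₂) (u₁ , u₂)) where

      φ : Fin n → Fin n
      φ w = proj₁ (sameColour-suc⇒midpoint (suc m) s w)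

      ψ : Fin n → Fin n
      ψ w = proj₁ (sameColour-suc⇒midpoint (suc m) (sameColour-sym (2 + m) s) w)

      row-φ : ∀ w → SameColour (suc m) (v₁ , w) (u₁ , φ w)
      row-φ w = proj₁ (proj₂ (sameColour-suc⇒midpoint (suc m) s w))

      row-ψ : ∀ w → SameColour (suc m) (u₁ , w) (v₁ , ψ w)
      row-ψ w = proj₁ (proj₂ (sameColour-suc⇒midpoint (suc m) (sameColour-sym (2 + m) s) w))

      ψ∘φ : ∀ w → ψ (φ w) ≡ w
      ψ∘φ w = sym (sameColour-targetUnique (sameColour-refl m (v₁ , w))
        (sameColour-suc⁻ m (sameColour-trans (suc m) (row-φ w) (row-ψ (φ w)))))

      φ∘ψ : ∀ w → φ (ψ w) ≡ w
      φ∘ψ w = sym (sameColour-targetUnique (sameColour-refl m (u₁ , w))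
        (sameColour-suc⁻ m (sameColour-trans (suc m) (row-ψ w) (row-φ (ψ w)))))

      -- The midpoint of row-φ y above x lies in row u₁ with the colour of (v₁ , x), so it is φ x.
      φ-preserves-c : ∀ x y → c (φ x) (φ y) ≡ c x y
      φ-preserves-c x y =
        let x′ , row-x′ , xy≈x′φy = sameColour-suc⇒midpoint m (row-φ y) x
            x′≡φx = sameColour-targetUnique row-x′ (sameColour-suc⁻ m (row-φ x))
        in sym (sameColour⇒c≡ m (subst (λ z → SameColour m (x , y) (z , φ y)) x′≡φx xy≈x′φy))

      φv₁≡u₁ : φ v₁ ≡ u₁
      φv₁≡u₁ = sym (vertexAx v₁ u₁ (φ v₁) (sym (sameColour⇒c≡ (suc m) (row-φ v₁))))

      φv₂≡u₂ : φ v₂ ≡ u₂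
      φv₂≡u₂ = sameColour-targetUnique (sameColour-suc⁻ m (row-φ v₂))
                 (sameColour-suc⁻ m (sameColour-suc⁻ (suc m) s))

      π : Permutation′ n
      π = permutation φ ψ φ∘ψ ψ∘φ

    sameColour-2+⇒3+ : ∀ {p q} → SameColour (2 + m) p q → SameColour (3 + m) p q
    sameColour-2+⇒3+ {v₁ , v₂} s =
      subst₂ (λ a b → SameColour (3 + m) (v₁ , v₂) (a , b)) φv₁≡u₁ φv₂≡u₂
             (sameColour-permute π φ-preserves-c (3 + m) v₁ v₂)
      where open Matching s

    walksWithin⇒stable : Stable 𝔛 (2 + m)
    walksWithin⇒stable p q = T-antisym (sameColour-suc⁻ (2 + m)) sameColour-2+⇒3+

  stable? : Decidable (Stable 𝔛)
  stable? h = ∀-pair? (λ p → ∀-pair? (λ q → sameColour 𝔛 (suc h) p q Bool.≟ sameColour 𝔛 h p q))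

theorem4 : (𝔛 : Configuration) → Connected 𝔛 → (D : ℕ) → IsDiameter 𝔛 D →
    ∃ λ h → IsWL 𝔛 h × h ≤ ⌊log₂ D ⌋ + 3
theorem4 𝔛 _ D (walksWithinD , _) =
  let walks = walksWithin-mono 𝔛 (ℕ.<⇒≤ (<2^suc⌊log₂⌋ D)) walksWithinD
      h , isWL , h≤ = least-satisfying (stable? 𝔛) (walksWithin⇒stable 𝔛 {suc ⌊log₂ D ⌋} walks)
  in h , isWL , ℕ.≤-trans h≤ (ℕ.≤-reflexive (ℕ.+-comm 3 ⌊log₂ D ⌋))
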